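{- Let $G_T=(V_T,E_T)$, $G_W=(V_W,E_W)$ be graphs with candidate sets $C[t]\subseteq V_W$ for $t\in V_T$, and let $G_C$ be the associated candidate structure. If $c_1,c_2\in V_W$ are fully candidate equivalent ($c_1\sim_c c_2$), then $c_1$ and $c_2$ are $G_C$-interchangeable.
   Context: A graph is a pair $G=(V,E)$ with $V$ finite and $E\subseteq V\times V$ (directed edges), with no self-loops. A subgraph isomorphism from $G_T$ to $G_W$ is an injective $f:V_T\to V_W$ with $(t_1,t_2)\in E_T\Rightarrow(f(t_1),f(t_2))\in E_W$. Two vertices $x,y$ of a directed graph $(V,E)$ are structurally equivalent ($x\sim_s y$) if for all $z\in V\setminus\{x,y\}$: $(z,x)\in E\Leftrightarrow(z,y)\in E$ and $(x,z)\in E\Leftrightarrow(y,z)\in E$, and moreover $(x,y)\in E\Leftrightarrow(y,x)\in E$. Given candidate sets $C[t]\subseteq V_W$ ($t\in V_T$), the candidate structure is the directed graph $G_C=(V_C,E_C)$ with $V_C=\{(t,c):t\in V_T,\ c\in C[t]\}$ and $((t_1,c_1),(t_2,c_2))\in E_C$ iff $(t_1,t_2)\in E_T$ and $(c_1,c_2)\in E_W$. For $u\in V_T$, $c_1\sim_{c,u}c_2$ means: either $c_1,c_2\notin C[u]$, or $c_1,c_2\in C[u]$ and $(u,c_1)\sim_s(u,c_2)$ in $G_C$. Full candidate equivalence: $c_1\sim_c c_2$ iff $c_1\sim_{c,u}c_2$ for all $u\in V_T$. A subgraph isomorphism $f$ is derived from $G_C$ if $f(t)\in C[t]$ for all $t$.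 World vertices $w_1,w_2$ are $G_C$-interchangeable if for every subgraph isomorphism $f$ derived from $G_C$: if both lie in the image of $f$, say $f(v)=w_1$, $f(w)=w_2$, then the map obtained from $f$ by setting $v\mapsto w_2$, $w\mapsto w_1$ is a subgraph isomorphism; and if only one lies in the image, say $f(v)=w_1$ (resp. $f(v)=w_2$), then the map obtained from $f$ by setting $v\mapsto w_2$ (resp. $v\mapsto w_1$) is a subgraph isomorphism. -}

module Defs where

open import Level using (0ℓ)
open import Data.Nat using (ℕ)
open import Data.Fin using (Fin; _≟_)
open import Data.Sum using (_⊎_; inj₁; inj₂)
open import Data.Product using (Σ; _×_; _,_; proj₁; proj₂)
open import Relation.Nullary using (¬_; yes; no)
open import Relation.Binary.PropositionalEquality using (_≡_; _≢_)
open import Function using (_⇔_)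

record Graph : Set₁ where
  field
    size   : ℕ
    E      : Fin size → Fin size → Set
    noLoop : ∀ v → ¬ E v v
open Graph public

V : Graph → Set
V G = Fin (size G)

IsSubIso : (GT GW : Graph) → (V GT → V GW) → Set
IsSubIso GT GW f =
  (∀ t₁ t₂ → f t₁ ≡ f t₂ → t₁ ≡ t₂) ×
  (∀ t₁ t₂ → E GT t₁ t₂ → E GW (f t₁) (f t₂))

Candidates : Graph → Graph → Set₁
Candidates GT GW = V GT → V GW → Set

module CandidateStructure (GT GW : Graph) (C : Candidates GT GW) where

  VC : Set
  VC = Σ (V GT × V GW) λ p → C (proj₁ p) (proj₂ p)

  node : VC → V GT × V GW
  node = proj₁

  EC : VC → VC → Set
  EC x y = E GT (proj₁ (node x)) (proj₁ (node y)) × E GW (proj₂ (node x)) (proj₂ (node y))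

  StructEquiv : VC → VC → Set
  StructEquiv x y =
    (∀ z → node z ≢ node x → node z ≢ node y →
       (EC z x ⇔ EC z y) × (EC x z ⇔ EC y z)) ×
    (EC x y ⇔ EC y x)

  CandEquivAt : V GT → V GW → V GW → Set
  CandEquivAt u c₁ c₂ =
    (¬ C u c₁ × ¬ C u c₂) ⊎
    (Σ (C u c₁) λ h₁ → Σ (C u c₂) λ h₂ → StructEquiv ((u , c₁) , h₁) ((u , c₂) , h₂))

  CandEquiv : V GW → V GW → Set
  CandEquiv c₁ c₂ = ∀ u → CandEquivAt u c₁ c₂

  Derived : (V GT → V GW) → Set
  Derived f = IsSubIso GT GW f × (∀ t → C t (f t))

  update : (V GT → V GW) → V GT → V GW → (V GT → V GW)
  update f v w x with x ≟ v
  ... | yes _ = w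
  ... | no  _ = f x

  Interchangeable : V GW → V GW → Set
  Interchangeable w₁ w₂ =
    ∀ f → Derived f →
      (∀ v w → f v ≡ w₁ → f w ≡ w₂ →
         IsSubIso GT GW (update (update f v w₂) w w₁)) ×
      (∀ v → f v ≡ w₁ → (∀ x → f x ≢ w₂) → IsSubIso GT GW (update f v w₂)) ×
      (∀ v → f v ≡ w₂ → (∀ x → f x ≢ w₁) → IsSubIso GT GW (update f v w₁))

module Submission where

open import Defs
open import Data.Fin using (_≟_)
open import Data.Sum using (inj₁; inj₂)
open import Data.Product using (Σ; _,_; proj₁; proj₂)
open import Data.Product.Properties using (,-injectiveˡ; ,-injectiveʳ)
open import Data.Empty using (⊥-elim)
open import Function using (_∘_)
open import Function.Bundles using (module Equivalence)
open import Function.Construct.Symmetry using (⇔-sym)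
open import Relation.Nullary using (¬_; yes; no)
open import Relation.Binary.PropositionalEquality using (_≡_; _≢_; refl; sym; trans; subst)

-- Each reassignment in the definition of interchangeability equals τ ∘ f, where
-- τ is the transposition of c₁ and c₂, so it suffices that τ ∘ f is a subgraph
-- isomorphism whenever f is derived from G_C. Injectivity is inherited from f.
-- For an edge (f t₁ , f t₂), the structural equivalence of (t , c₁) and (t , c₂)
-- in G_C moves an endpoint lying in {c₁ , c₂} to its partner, the other endpoint
-- being a common neighbour; and the two endpoints cannot both lie in {c₁ , c₂},
-- for moving one of them would then produce a loop in G_W.

data Transposed {A : Set} (c₁ c₂ : A) (a : A) : A → Set where
  first  : a ≡ c₁ → Transposed c₁ c₂ a c₂
  second : a ≡ c₂ → Transposed c₁ c₂ a c₁
  fixed  : a ≢ c₁ → a ≢ c₂ → Transposed c₁ c₂ a a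

transposed-injective : ∀ {A : Set} {c₁ c₂ a b a' : A} →
  Transposed c₁ c₂ a a' → Transposed c₁ c₂ b a' → a ≡ b
transposed-injective (first p)      (first q)      = trans p (sym q)
transposed-injective (first p)      (second q)     = trans p (sym q)
transposed-injective (first _)      (fixed _ b≢c₂) = ⊥-elim (b≢c₂ refl)
transposed-injective (second p)     (first q)      = trans p (sym q)
transposed-injective (second p)     (second q)     = trans p (sym q)
transposed-injective (second _)     (fixed b≢c₁ _) = ⊥-elim (b≢c₁ refl)
transposed-injective (fixed _ a≢c₂) (first _)      = ⊥-elim (a≢c₂ refl)
transposed-injective (fixed a≢c₁ _) (second _)     = ⊥-elim (a≢c₁ refl)
transposed-injective (fixed _ _)    (fixed _ _)    = refl

module CandidateInterchange (GT GW : Graph) (C : Candidates GT GW) where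
  open CandidateStructure GT GW C
  open Equivalence using (to)

  structEquiv-sym : ∀ {x y} → StructEquiv x y → StructEquiv y x
  structEquiv-sym (neighbours , between) =
    (λ z z≢y z≢x → let (ins , outs) = neighbours z z≢x z≢y in ⇔-sym ins , ⇔-sym outs) ,
    ⇔-sym between

  candEquiv-sym : ∀ {c₁ c₂} → CandEquiv c₁ c₂ → CandEquiv c₂ c₁
  candEquiv-sym ce u with ce u
  ... | inj₁ (∉₁ , ∉₂)      = inj₁ (∉₂ , ∉₁)
  ... | inj₂ (h₁ , h₂ , se) = inj₂ (h₂ , h₁ , structEquiv-sym {(u , _) , h₁} {(u , _) , h₂} se)

  -- StructEquiv only looks at the underlying pairs, so any membership proof will do.
  candEquiv-structEquiv : ∀ {c₁ c₂ u} → CandEquiv c₁ c₂ → (h₁ : C u c₁) →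
    Σ (C u c₂) λ h₂ → StructEquiv ((u , c₁) , h₁) ((u , c₂) , h₂)
  candEquiv-structEquiv {u = u} ce h₁ with ce u
  ... | inj₁ (∉₁ , _)      = ⊥-elim (∉₁ h₁)
  ... | inj₂ (_ , h₂ , se) = h₂ , se

  module _ {c₁ c₂ : V GW} (ce : CandEquiv c₁ c₂) {t₁ t₂ : V GT} (e : E GT t₁ t₂) where

    candEdge-moveSource : ∀ {b} → C t₁ c₁ → C t₂ b → b ≢ c₁ → b ≢ c₂ →
      E GW c₁ b → E GW c₂ b
    candEdge-moveSource h₁ hb b≢c₁ b≢c₂ w =
      let (_ , se) = candEquiv-structEquiv ce h₁
          (_ , outs) = proj₁ se ((t₂ , _) , hb) (b≢c₁ ∘ ,-injectiveʳ) (b≢c₂ ∘ ,-injectiveʳ)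
      in proj₂ (to outs (e , w))

    candEdge-moveTarget : ∀ {a} → C t₂ c₁ → C t₁ a → a ≢ c₁ → a ≢ c₂ →
      E GW a c₁ → E GW a c₂
    candEdge-moveTarget h₁ ha a≢c₁ a≢c₂ w =
      let (_ , se) = candEquiv-structEquiv ce h₁
          (ins , _) = proj₁ se ((t₁ , _) , ha) (a≢c₁ ∘ ,-injectiveʳ) (a≢c₂ ∘ ,-injectiveʳ)
      in proj₂ (to ins (e , w))

    candEdge-not-between : C t₁ c₁ → C t₂ c₂ → ¬ E GW c₁ c₂
    candEdge-not-between h₁ h₂ w =
      let t₂≢t₁ : t₂ ≢ t₁
          t₂≢t₁ t₂≡t₁ = noLoop GT t₁ (subst (E GT t₁) t₂≡t₁ e)
          (_ , se) = candEquiv-structEquiv ce h₁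
          (_ , outs) = proj₁ se ((t₂ , c₂) , h₂) (t₂≢t₁ ∘ ,-injectiveˡ) (t₂≢t₁ ∘ ,-injectiveˡ)
      in noLoop GW c₂ (proj₂ (to outs (e , w)))

  transposed-edge : ∀ {c₁ c₂} → CandEquiv c₁ c₂ → ∀ {t₁ t₂ a b a' b'} →
    E GT t₁ t₂ → C t₁ a → C t₂ b → E GW a b →
    Transposed c₁ c₂ a a' → Transposed c₁ c₂ b b' → E GW a' b'
  transposed-edge ce e ha hb w (first refl) (first refl) = ⊥-elim (noLoop GW _ w)
  transposed-edge ce e ha hb w (first refl) (second refl) =
    ⊥-elim (candEdge-not-between ce e ha hb w)
  transposed-edge ce e ha hb w (first refl) (fixed b≢c₁ b≢c₂) =
    candEdge-moveSource ce e ha hb b≢c₁ b≢c₂ w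
  transposed-edge ce e ha hb w (second refl) (first refl) =
    ⊥-elim (candEdge-not-between (candEquiv-sym ce) e ha hb w)
  transposed-edge ce e ha hb w (second refl) (second refl) = ⊥-elim (noLoop GW _ w)
  transposed-edge ce e ha hb w (second refl) (fixed b≢c₁ b≢c₂) =
    candEdge-moveSource (candEquiv-sym ce) e ha hb b≢c₂ b≢c₁ w
  transposed-edge ce e ha hb w (fixed a≢c₁ a≢c₂) (first refl) =
    candEdge-moveTarget ce e hb ha a≢c₁ a≢c₂ w
  transposed-edge ce e ha hb w (fixed a≢c₁ a≢c₂) (second refl) =
    candEdge-moveTarget (candEquiv-sym ce) e hb ha a≢c₂ a≢c₁ w
  transposed-edge ce e ha hb w (fixed _ _) (fixed _ _) = w

  transposed-isSubIso : ∀ {c₁ c₂} → CandEquiv c₁ c₂ → ∀ {f g} → Derived f →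
    (∀ x → Transposed c₁ c₂ (f x) (g x)) → IsSubIso GT GW g
  transposed-isSubIso ce ((f-injective , f-edge) , f-cand) τ =
    (λ t₁ t₂ g≡ → f-injective t₁ t₂
      (transposed-injective (τ t₁) (subst (Transposed _ _ _) (sym g≡) (τ t₂)))) ,
    (λ t₁ t₂ e → transposed-edge ce e (f-cand t₁) (f-cand t₂) (f-edge t₁ t₂ e) (τ t₁) (τ t₂))

  module _ {c₁ c₂ : V GW} {f : V GT → V GW} (f-injective : ∀ t₁ t₂ → f t₁ ≡ f t₂ → t₁ ≡ t₂) where

    private
      avoids : ∀ {v x c} → f v ≡ c → x ≢ v → f x ≢ c
      avoids fv≡c x≢v fx≡c = x≢v (f-injective _ _ (trans fx≡c (sym fv≡c)))

    update-transposes-both : ∀ {v w} → f v ≡ c₁ → f w ≡ c₂ →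
      ∀ x → Transposed c₁ c₂ (f x) (update (update f v c₂) w c₁ x)
    update-transposes-both {v} {w} fv≡c₁ fw≡c₂ x with x ≟ w
    ... | yes refl = second fw≡c₂
    ... | no x≢w with x ≟ v
    ...   | yes refl = first fv≡c₁
    ...   | no x≢v   = fixed (avoids fv≡c₁ x≢v) (avoids fw≡c₂ x≢w)

    update-transposes-first : ∀ {v} → f v ≡ c₁ → (∀ x → f x ≢ c₂) →
      ∀ x → Transposed c₁ c₂ (f x) (update f v c₂ x)
    update-transposes-first {v} fv≡c₁ ∉c₂ x with x ≟ v
    ... | yes refl = first fv≡c₁
    ... | no x≢v   = fixed (avoids fv≡c₁ x≢v) (∉c₂ x)

    update-transposes-second : ∀ {v} → f v ≡ c₂ → (∀ x → f x ≢ c₁) →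
      ∀ x → Transposed c₁ c₂ (f x) (update f v c₁ x)
    update-transposes-second {v} fv≡c₂ ∉c₁ x with x ≟ v
    ... | yes refl = second fv≡c₂
    ... | no x≢v   = fixed (∉c₁ x) (avoids fv≡c₂ x≢v)

proposition7 : (GT GW : Graph) (C : Candidates GT GW) (c₁ c₂ : V GW) →
    CandidateStructure.CandEquiv GT GW C c₁ c₂ →
    CandidateStructure.Interchangeable GT GW C c₁ c₂
proposition7 GT GW C c₁ c₂ ce f derived@((f-injective , _) , _) =
  (λ _ _ fv≡c₁ fw≡c₂ → via (update-transposes-both f-injective fv≡c₁ fw≡c₂)) ,
  (λ _ fv≡c₁ ∉c₂ → via (update-transposes-first f-injective fv≡c₁ ∉c₂)) ,
  (λ _ fv≡c₂ ∉c₁ → via (update-transposes-second f-injective fv≡c₂ ∉c₁))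
  where
  open CandidateInterchange GT GW C
  via : ∀ {g} → (∀ x → Transposed c₁ c₂ (f x) (g x)) → IsSubIso GT GW g
  via = transposed-isSubIso ce derived
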